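{- Let $s,t$ be positive integers and $k \ge 0$ an integer. Among all pairs $(A,B)$ of finite sets of rational integers with $|A|=s$ and $|B|=t$, the number of pairs $(a,b)\in A\times B$ with $|a-b|\le k$ is maximal when each of $A$ and $B$ is a set of consecutive integers and the midpoints of the segments $[\min A,\max A]$ and $[\min B,\max B]$ are equal (if $s\equiv t \pmod 2$) or differ by $\tfrac12$ (otherwise). -}

module Defs where

open import Data.Nat as ℕ using (ℕ; _≤?_)
open import Data.Integer as ℤ using (ℤ; +_; ∣_∣; _-_; _+_)
open import Data.List using (List; map; filter; length; upTo)
open import Data.Nat.ListAction using (sum)

-- Number of pairs (a , b) ∈ A × B with |a - b| ≤ k,
-- for finite sets A, B of integers represented as duplicate-free lists.
closePairs : ℕ → List ℤ → List ℤ → ℕ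
closePairs k A B = sum (map (λ a → length (filter (λ b → ∣ a - b ∣ ≤? k) B)) A)

consecutive : ℤ → ℕ → List ℤ
consecutive a₀ n = map (λ i → a₀ + + i) (upTo n)

module Submission where

-- Induction on |A| + |B|. Let α = max A, β = max B, and let X (resp. Y) be the
-- number of elements of B within distance k of α (resp. of A within distance k
-- of β); deleting α or β loses exactly X or Y pairs. Both X and Y are at most
-- 2k + 1 and at most the size of the other set, and since B lies below β and A
-- below α, X + Y ≤ 2k + 2. For the centred blocks, orient them so that the
-- midpoint of the A-block is at or half a unit above that of the B-block. Then
-- deleting the top of the A-block or the bottom of the B-block keeps the blocks
-- centred, and counting the integers in the relevant windows shows that the top
-- of the A-block has at least X neighbours or the bottom of the B-block at least
-- Y. Deleting the matching points on both sides and applying the induction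
-- hypothesis gives the bound.

open import Defs

module Rearrangement where

  open import Algebra.Properties.CommutativeSemigroup using (interchange)
  open import Data.Nat
  open import Data.Nat.Properties
  import Data.Nat.Tactic.RingSolver as ℕ-Solver
  open import Data.Nat.ListAction.Properties using (sum-↭)
  open import Data.Integer as ℤ using (ℤ; +_; -[1+_]; ∣_∣)
  import Data.Integer.Properties as ℤP
  open import Data.Integer.Tactic.RingSolver using (solve-∀)
  open import Data.List using (List; []; _∷_; _∷ʳ_; map; filter; length; upTo; applyUpTo)
  import Data.List.Properties as List
  open import Data.List.Membership.Propositional using (_∈_)
  open import Data.List.Membership.Propositional.Properties
    using (∈-map⁺; ∈-map⁻; ∈-filter⁺; ∈-filter⁻; ∈-upTo⁺; ∈-upTo⁻)
  open import Data.List.Relation.Binary.Permutation.Propositional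
    using (_↭_; ↭-refl; ↭-sym; ↭-trans; prep; swap; ↭⇒↭ₛ)
  import Data.List.Relation.Binary.Permutation.Propositional.Properties as Perm
  import Data.List.Relation.Binary.Permutation.Setoid.Properties as PermSetoid
  open import Data.List.Relation.Binary.Subset.Propositional using (_⊆_)
  open import Data.List.Relation.Unary.All as All using (All; []; _∷_)
  import Data.List.Relation.Unary.All.Properties as All
  open import Data.List.Relation.Unary.AllPairs using (_∷_)
  open import Data.List.Relation.Unary.Any using (here; there)
  open import Data.List.Relation.Unary.Unique.Propositional using (Unique)
  import Data.List.Relation.Unary.Unique.Propositional.Properties as Unique
  open import Data.Product using (∃-syntax; _×_; _,_)
  open import Data.Sum as Sum using (_⊎_; inj₁; inj₂)
  open import Function using (_∘_)
  open import Relation.Binary.Definitions using (DecidableEquality)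
  open import Relation.Binary.PropositionalEquality
  open import Relation.Binary.PropositionalEquality.Properties using (setoid)
  open import Relation.Nullary using (¬_; yes; no; ¬?; contradiction)

  ∣m-n∣≤o : ∀ {m n o} → m ≤ n + o → n ≤ m + o → ∣ m - n ∣ ≤ o
  ∣m-n∣≤o {m} {n} m≤n+o n≤m+o with ∣m-n∣≡[m∸n]∨[n∸m] m n
  ... | inj₁ eq = subst (_≤ _) (sym eq) (m≤n+o⇒m∸n≤o m n m≤n+o)
  ... | inj₂ eq = subst (_≤ _) (sym eq) (m≤n+o⇒m∸n≤o n m n≤m+o)

  <∸⇒+< : ∀ o {m n} → m < n ∸ o → o + m < n
  <∸⇒+< zero m<n = m<n
  <∸⇒+< (suc o) {n = suc n} m<n∸o = s≤s (<∸⇒+< o m<n∸o)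

  [m+n]∸[w+w]≤[m∸w]+[n∸w] : ∀ m n w → (m + n) ∸ (w + w) ≤ (m ∸ w) + (n ∸ w)
  [m+n]∸[w+w]≤[m∸w]+[n∸w] m n w = m≤n+o⇒m∸n≤o (m + n) (w + w) (begin
    m + n                           ≤⟨ +-mono-≤ (m≤n+m∸n m w) (m≤n+m∸n n w) ⟩
    (w + (m ∸ w)) + (w + (n ∸ w))   ≡⟨ interchange +-commutativeSemigroup w (m ∸ w) w (n ∸ w) ⟩
    (w + w) + ((m ∸ w) + (n ∸ w))   ∎)
    where open ≤-Reasoning

  x+y≤1+p+q⇒x≤p⊎y≤q : ∀ {x y p q} → x + y ≤ suc (p + q) → x ≤ p ⊎ y ≤ q
  x+y≤1+p+q⇒x≤p⊎y≤q {x} {y} {p} {q} x+y≤ with x ≤? p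
  ... | yes x≤p = inj₁ x≤p
  ... | no x≰p = inj₂ (+-cancelˡ-≤ p y q (≤-pred (≤-trans (+-monoˡ-≤ y (≰⇒> x≰p)) x+y≤)))

  ∣+m-+n∣ : ∀ m n → ∣ + m ℤ.- + n ∣ ≡ ∣ m - n ∣
  ∣+m-+n∣ m n rewrite ℤP.m-n≡m⊖n m n with ≤-total m n
  ... | inj₁ m≤n = trans (ℤP.∣⊖∣-≤ m≤n) (sym (m≤n⇒∣m-n∣≡n∸m m≤n))
  ... | inj₂ n≤m =
    trans (ℤP.∣m⊖n∣≡∣n⊖m∣ m n) (trans (ℤP.∣⊖∣-≤ n≤m) (sym (m≤n⇒∣n-m∣≡n∸m n≤m)))

  ∣[i+m]-[i+n]∣ : ∀ i m n → ∣ (i ℤ.+ + m) ℤ.- (i ℤ.+ + n) ∣ ≡ ∣ m - n ∣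
  ∣[i+m]-[i+n]∣ i m n = trans (cong ∣_∣ (cancel i (+ m) (+ n))) (∣+m-+n∣ m n)
    where
    cancel : ∀ i x y → (i ℤ.+ x) ℤ.- (i ℤ.+ y) ≡ x ℤ.- y
    cancel = solve-∀

  +-cancelˡ : ∀ i {x y} → i ℤ.+ x ≡ i ℤ.+ y → x ≡ y
  +-cancelˡ i {x} {y} eq = trans (sym (undo i x)) (trans (cong (ℤ._- i) eq) (undo i y))
    where
    undo : ∀ i x → (i ℤ.+ x) ℤ.- i ≡ x
    undo = solve-∀

  j-[j-i]≡i : ∀ i j → j ℤ.- (j ℤ.- i) ≡ i
  j-[j-i]≡i = solve-∀

  +∣j-i∣≡j-i : ∀ {i j} → i ℤ.≤ j → + ∣ j ℤ.- i ∣ ≡ j ℤ.- i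
  +∣j-i∣≡j-i i≤j = ℤP.0≤i⇒+∣i∣≡i (ℤP.i≤j⇒0≤j-i i≤j)

  i≤j⇒i≡j-∣j-i∣ : ∀ {i j} → i ℤ.≤ j → i ≡ j ℤ.- + ∣ j ℤ.- i ∣
  i≤j⇒i≡j-∣j-i∣ {i} {j} i≤j =
    trans (sym (j-[j-i]≡i i j)) (cong (ℤ._-_ j) (sym (+∣j-i∣≡j-i i≤j)))

  i≤j⇒j≡i+∣j-i∣ : ∀ {i j} → i ℤ.≤ j → j ≡ i ℤ.+ + ∣ j ℤ.- i ∣
  i≤j⇒j≡i+∣j-i∣ {i} {j} i≤j = trans (add-sub i j) (cong (ℤ._+_ i) (sym (+∣j-i∣≡j-i i≤j)))
    where
    add-sub : ∀ i j → j ≡ i ℤ.+ (j ℤ.- i)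
    add-sub = solve-∀

  ∣[j+u]-i∣ : ∀ {i j} u → i ℤ.≤ j → ∣ (j ℤ.+ + u) ℤ.- i ∣ ≡ ∣ j ℤ.- i ∣ + u
  ∣[j+u]-i∣ {i} {j} u i≤j =
    cong ∣_∣ (trans (shift j i (+ u)) (cong (ℤ._+ + u) (sym (+∣j-i∣≡j-i i≤j))))
    where
    shift : ∀ j i u → (j ℤ.+ u) ℤ.- i ≡ (j ℤ.- i) ℤ.+ u
    shift = solve-∀

  ∣i∣≤1-cases : ∀ {i} → ∣ i ∣ ≤ 1 → (∃[ d ] d ≤ 1 × i ≡ + d) ⊎ i ≡ -[1+ 0 ]
  ∣i∣≤1-cases {+ d} d≤1 = inj₁ (d , d≤1 , refl)
  ∣i∣≤1-cases { -[1+ 0 ]} _ = inj₂ refl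
  ∣i∣≤1-cases { -[1+ suc _ ]} (s≤s ())

  ∣d-1∣≤1 : ∀ {d} → d ≤ 1 → ∣ + d ℤ.- + 1 ∣ ≤ 1
  ∣d-1∣≤1 z≤n = ≤-refl
  ∣d-1∣≤1 (s≤s z≤n) = z≤n

  halve : ∀ {m i} → + m ≡ + 2 ℤ.* i → ∃[ g ] i ≡ + g × m ≡ g + g
  halve {i = + g} m≡2g = g , refl , trans (ℤP.+-injective (trans m≡2g (sym (ℤP.pos-* 2 g))))
                                          (cong (_+_ g) (+-identityʳ g))
  halve {i = -[1+ _ ]} ()

  module _ {A : Set} (_≟_ : DecidableEquality A) where

    length≤1+length-filter-≢ : ∀ y {xs : List A} → Unique xs →
                               length xs ≤ suc (length (filter (λ x → ¬? (x ≟ y)) xs))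
    length≤1+length-filter-≢ y {[]} _ = z≤n
    length≤1+length-filter-≢ y {x ∷ xs} (x∉xs ∷ u) with x ≟ y
    ... | yes refl = s≤s (≤-reflexive (cong length (sym (List.filter-all (λ x → ¬? (x ≟ y))
                       (All.map (λ y≢z z≡y → y≢z (sym z≡y)) x∉xs)))))
    ... | no _ = s≤s (length≤1+length-filter-≢ y u)

    unique-⊆⇒length≤ : ∀ {xs} ys → Unique xs → xs ⊆ ys → length xs ≤ length ys
    unique-⊆⇒length≤ {[]} _ _ _ = z≤n
    unique-⊆⇒length≤ {x ∷ xs} [] _ x∷xs⊆[] with () ← x∷xs⊆[] (here refl)
    unique-⊆⇒length≤ {xs} (y ∷ ys) u xs⊆y∷ys =
      ≤-trans (length≤1+length-filter-≢ y u)
              (s≤s (unique-⊆⇒length≤ ys (Unique.filter⁺ _ u) rest⊆ys))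
      where
      rest⊆ys : filter (λ x → ¬? (x ≟ y)) xs ⊆ ys
      rest⊆ys x∈ with x∈xs , x≢y ← ∈-filter⁻ (λ x → ¬? (x ≟ y)) x∈ with xs⊆y∷ys x∈xs
      ... | here x≡y = contradiction x≡y x≢y
      ... | there x∈ys = x∈ys

    length≤-of-image : ∀ (φ : ℕ → A) n {xs} → Unique xs →
                       All (λ x → ∃[ w ] w < n × x ≡ φ w) xs → length xs ≤ n
    length≤-of-image φ n {xs} u in-image =
      subst (length xs ≤_) (trans (List.length-map φ (upTo n)) (List.length-upTo n))
        (unique-⊆⇒length≤ (map φ (upTo n)) u λ x∈xs →
          let w , w<n , x≡φw = All.lookup in-image x∈xs in
          subst (_∈ map φ (upTo n)) (sym x≡φw) (∈-map⁺ φ (∈-upTo⁺ w<n)))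

  neighbours : ℕ → ℤ → List ℤ → ℕ
  neighbours k x B = length (filter (λ b → ∣ x ℤ.- b ∣ ≤? k) B)

  neighbours-∷ : ∀ k x b B → neighbours k x (b ∷ B) ≡ neighbours k x (b ∷ []) + neighbours k x B
  neighbours-∷ k x b B =
    trans (cong length (List.filter-++ near? (b ∷ []) B)) (List.length-++ (filter near? (b ∷ [])))
    where
    near? = λ b → ∣ x ℤ.- b ∣ ≤? k

  neighbours-sym : ∀ k a b → neighbours k a (b ∷ []) ≡ neighbours k b (a ∷ [])
  neighbours-sym k a b with ∣ a ℤ.- b ∣ ≤? k
  ... | yes near = trans (cong length (List.filter-accept (near? a) near))
    (sym (cong length (List.filter-accept (near? b) (subst (_≤ k) (ℤP.∣i-j∣≡∣j-i∣ a b) near))))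
    where near? = λ x z → ∣ x ℤ.- z ∣ ≤? k
  ... | no far = trans (cong length (List.filter-reject (near? a) far))
    (sym (cong length (List.filter-reject (near? b) (far ∘ subst (_≤ k) (ℤP.∣i-j∣≡∣j-i∣ b a)))))
    where near? = λ x z → ∣ x ℤ.- z ∣ ≤? k

  closePairs-[]ʳ : ∀ k A → closePairs k A [] ≡ 0
  closePairs-[]ʳ k [] = refl
  closePairs-[]ʳ k (a ∷ A) = closePairs-[]ʳ k A

  closePairs-∷ʳ : ∀ k A b B → closePairs k A (b ∷ B) ≡ neighbours k b A + closePairs k A B
  closePairs-∷ʳ k [] b B = refl
  closePairs-∷ʳ k (a ∷ A) b B = begin
    neighbours k a (b ∷ B) + closePairs k A (b ∷ B)
      ≡⟨ cong₂ _+_ (neighbours-∷ k a b B) (closePairs-∷ʳ k A b B) ⟩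
    (neighbours k a (b ∷ []) + neighbours k a B) + (neighbours k b A + closePairs k A B)
      ≡⟨ cong (λ n → (n + neighbours k a B) + (neighbours k b A + closePairs k A B)) (neighbours-sym k a b) ⟩
    (neighbours k b (a ∷ []) + neighbours k a B) + (neighbours k b A + closePairs k A B)
      ≡⟨ interchange +-commutativeSemigroup (neighbours k b (a ∷ [])) _ _ _ ⟩
    (neighbours k b (a ∷ []) + neighbours k b A) + (neighbours k a B + closePairs k A B)
      ≡⟨ cong (_+ (neighbours k a B + closePairs k A B)) (neighbours-∷ k b a A) ⟨
    neighbours k b (a ∷ A) + closePairs k (a ∷ A) B
      ∎
    where open ≡-Reasoning

  closePairs-comm : ∀ k A B → closePairs k A B ≡ closePairs k B A
  closePairs-comm k A [] = closePairs-[]ʳ k A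
  closePairs-comm k A (b ∷ B) =
    trans (closePairs-∷ʳ k A b B) (cong (_+_ (neighbours k b A)) (closePairs-comm k A B))

  closePairs-cong-↭ˡ : ∀ k {A A′} B → A ↭ A′ → closePairs k A B ≡ closePairs k A′ B
  closePairs-cong-↭ˡ k B A↭A′ = sum-↭ (Perm.map⁺ (λ a → neighbours k a B) A↭A′)

  closePairs-cong-↭ʳ : ∀ k A {B B′} → B ↭ B′ → closePairs k A B ≡ closePairs k A B′
  closePairs-cong-↭ʳ k A {B} {B′} B↭B′ =
    trans (closePairs-comm k A B) (trans (closePairs-cong-↭ˡ k A B↭B′) (closePairs-comm k B′ A))

  extract-max : ∀ x xs → ∃[ α ] ∃[ A′ ] (x ∷ xs ↭ α ∷ A′) × All (ℤ._≤ α) A′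
  extract-max x [] = x , [] , ↭-refl , []
  extract-max x (y ∷ ys) with extract-max y ys
  ... | α , A′ , y∷ys↭ , A′≤α with ℤP.≤-total x α
  ...   | inj₁ x≤α = α , x ∷ A′ , ↭-trans (prep x y∷ys↭) (swap x α ↭-refl) , x≤α ∷ A′≤α
  ...   | inj₂ α≤x =
    x , α ∷ A′ , prep x y∷ys↭ , α≤x ∷ All.map (λ z≤α → ℤP.≤-trans z≤α α≤x) A′≤α

  extracted-unique : ∀ {x xs α A′} → x ∷ xs ↭ α ∷ A′ → Unique (x ∷ xs) → Unique A′
  extracted-unique x∷xs↭ u with PermSetoid.Unique-resp-↭ (setoid ℤ) (↭⇒↭ₛ x∷xs↭) u
  ... | _ ∷ u′ = u′

  extracted-length : ∀ {x α : ℤ} {xs A′} → x ∷ xs ↭ α ∷ A′ → length A′ ≡ length xs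
  extracted-length x∷xs↭ = suc-injective (sym (Perm.↭-length x∷xs↭))

  extracted-max : ∀ {x xs α A′} → x ∷ xs ↭ α ∷ A′ → All (ℤ._≤ α) A′ →
                  All (ℤ._≤ α) (x ∷ xs)
  extracted-max x∷xs↭ A′≤α = Perm.All-resp-↭ (↭-sym x∷xs↭) (ℤP.≤-refl ∷ A′≤α)

  neighbours≤-of-image : ∀ k x {B} (φ : ℕ → ℤ) n → Unique B →
                         All (λ b → ∣ x ℤ.- b ∣ ≤ k → ∃[ w ] w < n × b ≡ φ w) B →
                         neighbours k x B ≤ n
  neighbours≤-of-image k x {B} φ n u near⇒in-image =
    length≤-of-image ℤ._≟_ φ n (Unique.filter⁺ near? u)
      (All.zipWith (λ (in-image , near) → in-image near)
                   (All.filter⁺ near? near⇒in-image , All.all-filter near? B))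
    where
    near? = λ b → ∣ x ℤ.- b ∣ ≤? k

  neighbours≤2k+1 : ∀ k x {B} → Unique B → neighbours k x B ≤ suc (k + k)
  neighbours≤2k+1 k x u = neighbours≤-of-image k x (λ w → (x ℤ.+ + k) ℤ.- + w) (suc (k + k)) u
    (All.universal (λ b near → let w , w≤2k , eq = shift (x ℤ.- b) near in
       w , s≤s w≤2k , trans (recover x b (+ k)) (cong (ℤ._-_ (x ℤ.+ + k)) eq)) _)
    where
    shift : ∀ z → ∣ z ∣ ≤ k → ∃[ w ] w ≤ k + k × z ℤ.+ + k ≡ + w
    shift (+ n) n≤k = n + k , +-monoˡ-≤ k n≤k , refl
    shift -[1+ n ] 1+n≤k = k ∸ suc n , ≤-trans (m∸n≤m k (suc n)) (m≤m+n k k) , ℤP.⊖-≥ 1+n≤k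
    recover : ∀ x b c → b ≡ (x ℤ.+ c) ℤ.- ((x ℤ.- b) ℤ.+ c)
    recover = solve-∀

  neighbours-above-max : ∀ k u {B β} → Unique B → All (ℤ._≤ β) B →
                         neighbours k (β ℤ.+ + u) B ≤ suc k ∸ u
  neighbours-above-max k u {β = β} uB B≤β =
    neighbours≤-of-image k (β ℤ.+ + u) (λ w → β ℤ.- + w) (suc k ∸ u) uB
    (All.map (λ {b} b≤β near → ∣ β ℤ.- b ∣ ,
                 m+n≤o⇒m≤o∸n (suc ∣ β ℤ.- b ∣) (s≤s (subst (_≤ k) (∣[j+u]-i∣ u b≤β) near)) ,
                 i≤j⇒i≡j-∣j-i∣ b≤β)
             B≤β)

  neighbours-below-max : ∀ k u {A β} → Unique A → All (ℤ._≤ β ℤ.+ + u) A →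
                         neighbours k β A ≤ suc (u + k)
  neighbours-below-max k u {β = β} uA A≤α =
    neighbours≤-of-image k β (λ w → α ℤ.- + w) (suc (u + k)) uA
    (All.map (λ {a} a≤α near → ∣ α ℤ.- a ∣ ,
                 s≤s (≤-trans (m≤n+∣m-n∣ ∣ α ℤ.- a ∣ u)
                              (+-monoʳ-≤ u (subst (_≤ k) (distance a≤α) near))) ,
                 i≤j⇒i≡j-∣j-i∣ a≤α)
             A≤α)
    where
    α = β ℤ.+ + u
    unshift : ∀ β a u → β ℤ.- a ≡ ((β ℤ.+ u) ℤ.- a) ℤ.- u
    unshift = solve-∀
    distance : ∀ {a} → a ℤ.≤ α → ∣ β ℤ.- a ∣ ≡ ∣ ∣ α ℤ.- a ∣ - u ∣
    distance {a} a≤α =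
      trans (cong ∣_∣ (trans (unshift β a (+ u)) (cong (ℤ._- + u) (sym (+∣j-i∣≡j-i a≤α)))))
            (∣+m-+n∣ ∣ α ℤ.- a ∣ u)

  neighbours-of-ordered-maxima : ∀ k {A B α β} → Unique A → Unique B →
                                 All (ℤ._≤ α) A → All (ℤ._≤ β) B → β ℤ.≤ α →
                                 neighbours k α B + neighbours k β A ≤ 2 + (k + k)
  neighbours-of-ordered-maxima k {A} {B} {α} {β} uA uB A≤α B≤β β≤α
    with ∣ α ℤ.- β ∣ | i≤j⇒j≡i+∣j-i∣ β≤α
  ... | u | refl with u ≤? k
  ...   | yes u≤k = begin
    neighbours k (β ℤ.+ + u) B + neighbours k β A
      ≤⟨ +-mono-≤ (neighbours-above-max k u uB B≤β) (neighbours-below-max k u {β = β} uA A≤α) ⟩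
    (suc k ∸ u) + suc (u + k)   ≡⟨ +-suc (suc k ∸ u) (u + k) ⟩
    suc ((suc k ∸ u) + (u + k)) ≡⟨ cong suc (+-assoc (suc k ∸ u) u k) ⟨
    suc ((suc k ∸ u + u) + k)   ≡⟨ cong (λ n → suc (n + k)) (m∸n+n≡m (m≤n⇒m≤1+n u≤k)) ⟩
    2 + (k + k)                 ∎
    where open ≤-Reasoning
  ...   | no u≰k = begin
    neighbours k (β ℤ.+ + u) B + neighbours k β A
      ≤⟨ +-mono-≤ (neighbours-above-max k u uB B≤β) (neighbours≤2k+1 k β uA) ⟩
    (suc k ∸ u) + suc (k + k)   ≡⟨ cong (_+ suc (k + k)) (m≤n⇒m∸n≡0 (≰⇒> u≰k)) ⟩
    suc (k + k)                 ≤⟨ n≤1+n _ ⟩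
    2 + (k + k)                 ∎
    where open ≤-Reasoning

  neighbours-of-maxima : ∀ k {A B α β} → Unique A → Unique B → All (ℤ._≤ α) A → All (ℤ._≤ β) B →
                         neighbours k α B + neighbours k β A ≤ 2 + (k + k)
  neighbours-of-maxima k {A} {B} {α} {β} uA uB A≤α B≤β with ℤP.≤-total β α
  ... | inj₁ β≤α = neighbours-of-ordered-maxima k uA uB A≤α B≤β β≤α
  ... | inj₂ α≤β = subst (_≤ 2 + (k + k)) (+-comm (neighbours k β A) (neighbours k α B))
                     (neighbours-of-ordered-maxima k uB uA B≤β A≤α α≤β)

  -- windowCount k g n is the number of j < n with ∣ g - j ∣ ≤ k.
  windowCount : ℕ → ℕ → ℕ → ℕ
  windowCount k g n = (n ⊓ suc (g + k)) ∸ (g ∸ k)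

  windowCount-near : ∀ {k g} n → g ≤ k → windowCount k g n ≡ n ⊓ suc (g + k)
  windowCount-near {k} {g} n g≤k = cong (_∸_ (n ⊓ suc (g + k))) (m≤n⇒m∸n≡0 g≤k)

  windowCount-far : ∀ k w n → windowCount k (k + w) n ≡ (n ∸ w) ⊓ suc (k + k)
  windowCount-far k w n = begin
    (n ⊓ suc ((k + w) + k)) ∸ ((k + w) ∸ k)   ≡⟨ cong (_∸_ (n ⊓ _)) (m+n∸m≡n k w) ⟩
    (n ⊓ suc ((k + w) + k)) ∸ w               ≡⟨ ∸-distribʳ-⊓ w n _ ⟩
    (n ∸ w) ⊓ (suc ((k + w) + k) ∸ w)         ≡⟨ cong (λ m → (n ∸ w) ⊓ (m ∸ w)) (rearrange k w) ⟩
    (n ∸ w) ⊓ ((suc (k + k) + w) ∸ w)         ≡⟨ cong ((n ∸ w) ⊓_) (m+n∸n≡m (suc (k + k)) w) ⟩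
    (n ∸ w) ⊓ suc (k + k)                     ∎
    where
    open ≡-Reasoning
    rearrange : ∀ k w → suc ((k + w) + k) ≡ suc (k + k) + w
    rearrange = ℕ-Solver.solve-∀

  windowCount≤neighbours : ∀ k e g {n L} (φ : ℕ → ℤ) → (∀ {i j} → φ i ≡ φ j → i ≡ j) →
                           (∀ j → ∣ e ℤ.- φ j ∣ ≡ ∣ g - j ∣) → (∀ {j} → j < n → φ j ∈ L) →
                           windowCount k g n ≤ neighbours k e L
  windowCount≤neighbours k e g {n} {L} φ φ-injective distance φ∈L =
    subst (_≤ neighbours k e L) (trans (List.length-map run (upTo c)) (List.length-upTo c))
      (unique-⊆⇒length≤ ℤ._≟_ _ (Unique.map⁺ (+-cancelˡ-≡ start _ _ ∘ φ-injective) (Unique.upTo⁺ c))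
                                run⊆)
    where
    start = g ∸ k
    c = windowCount k g n
    run : ℕ → ℤ
    run i = φ (start + i)
    run⊆ : map run (upTo c) ⊆ filter (λ b → ∣ e ℤ.- b ∣ ≤? k) L
    run⊆ z∈ with i , i∈ , refl ← ∈-map⁻ run z∈ =
      ∈-filter⁺ (λ b → ∣ e ℤ.- b ∣ ≤? k) (φ∈L j<n) near
      where
      j = start + i
      j<end : j < n ⊓ suc (g + k)
      j<end = <∸⇒+< start (∈-upTo⁻ i∈)
      j<n : j < n
      j<n = <-≤-trans j<end (m⊓n≤m n _)
      g≤j+k : g ≤ j + k
      g≤j+k = ≤-trans (m≤n+m∸n g k) (subst (k + start ≤_) (+-comm k j) (+-monoʳ-≤ k (m≤m+n start i)))
      near : ∣ e ℤ.- φ j ∣ ≤ k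
      near = subst (_≤ k) (sym (distance j)) (∣m-n∣≤o g≤j+k (≤-pred (<-≤-trans j<end (m⊓n≤n n _))))

  windowCount≤neighbours-above-bottom : ∀ k b g t →
                                        windowCount k g t ≤ neighbours k (b ℤ.+ + g) (consecutive b t)
  windowCount≤neighbours-above-bottom k b g t =
    windowCount≤neighbours k (b ℤ.+ + g) g (λ j → b ℤ.+ + j) (ℤP.+-injective ∘ +-cancelˡ b)
      (∣[i+m]-[i+n]∣ b g) (λ j<t → ∈-map⁺ (λ j → b ℤ.+ + j) (∈-upTo⁺ j<t))

  windowCount≤neighbours-below-top : ∀ k a s′ e g → e ℤ.+ + g ≡ a ℤ.+ + s′ →
                                     windowCount k g (suc s′) ≤ neighbours k e (consecutive a (suc s′))
  windowCount≤neighbours-below-top k a s′ e g e+g≡top =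
    windowCount≤neighbours k e g (λ j → top ℤ.- + j) injective distance membership
    where
    top = e ℤ.+ + g
    injective : ∀ {i j} → top ℤ.- + i ≡ top ℤ.- + j → i ≡ j
    injective {i} {j} eq = ℤP.+-injective (trans (sym (j-[j-i]≡i (+ i) top))
                                                 (trans (cong (ℤ._-_ top) eq) (j-[j-i]≡i (+ j) top)))
    down : ∀ e g j → e ℤ.- ((e ℤ.+ g) ℤ.- j) ≡ j ℤ.- g
    down = solve-∀
    distance : ∀ j → ∣ e ℤ.- (top ℤ.- + j) ∣ ≡ ∣ g - j ∣
    distance j = trans (cong ∣_∣ (down e (+ g) (+ j))) (trans (∣+m-+n∣ j g) (∣-∣-comm j g))
    regroup : ∀ a s j → (a ℤ.+ s) ℤ.- j ≡ a ℤ.+ (s ℤ.- j)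
    regroup = solve-∀
    membership : ∀ {j} → j < suc s′ → top ℤ.- + j ∈ consecutive a (suc s′)
    membership {j} (s≤s j≤s′) = subst (_∈ consecutive a (suc s′)) (sym top-j≡)
      (∈-map⁺ (λ i → a ℤ.+ + i) (∈-upTo⁺ (s≤s (m∸n≤m s′ j))))
      where
      top-j≡ : top ℤ.- + j ≡ a ℤ.+ + (s′ ∸ j)
      top-j≡ = begin
        top ℤ.- + j              ≡⟨ cong (ℤ._- + j) e+g≡top ⟩
        (a ℤ.+ + s′) ℤ.- + j     ≡⟨ regroup a (+ s′) (+ j) ⟩
        a ℤ.+ (+ s′ ℤ.- + j)     ≡⟨ cong (ℤ._+_ a) (trans (ℤP.m-n≡m⊖n s′ j) (ℤP.⊖-≥ j≤s′)) ⟩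
        a ℤ.+ + (s′ ∸ j)         ∎
        where open ≡-Reasoning

  decide-removal : ∀ k g {s t X Y} → X ≤ t → Y ≤ s → X ≤ suc (k + k) → Y ≤ suc (k + k) →
                   X + Y ≤ 2 + (k + k) → g + g < s + t →
                   X ≤ windowCount k g t ⊎ Y ≤ windowCount k g s
  decide-removal k g {s} {t} {X} {Y} X≤t Y≤s X≤2k+1 Y≤2k+1 X+Y≤ 2g<s+t with ≤-total g k
  ... | inj₁ g≤k = Sum.map
    (λ X≤ → subst (X ≤_) (sym (windowCount-near t g≤k)) (⊓-glb X≤t X≤))
    (λ Y≤ → subst (Y ≤_) (sym (windowCount-near s g≤k)) (⊓-glb Y≤s Y≤))
    (x+y≤1+p+q⇒x≤p⊎y≤q (≤-trans X+Y≤
      (s≤s (+-mono-≤ (s≤s (m≤n+m k g)) (m≤n⇒m≤1+n (m≤n+m k g))))))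
  ... | inj₂ k≤g = far (g ∸ k) (m+[n∸m]≡n k≤g)
    where
    far : ∀ w → k + w ≡ g → X ≤ windowCount k g t ⊎ Y ≤ windowCount k g s
    far w refl = Sum.map
      (λ X≤ → subst (X ≤_) (sym (windowCount-far k w t)) (⊓-glb X≤ X≤2k+1))
      (λ Y≤ → subst (Y ≤_) (sym (windowCount-far k w s)) (⊓-glb Y≤ Y≤2k+1))
      (x+y≤1+p+q⇒x≤p⊎y≤q (≤-trans X+Y≤
        (s≤s (≤-trans room ([m+n]∸[w+w]≤[m∸w]+[n∸w] t s w)))))
      where
      rearrange : ∀ k w → suc ((k + w) + (k + w)) ≡ suc (k + k) + (w + w)
      rearrange = ℕ-Solver.solve-∀
      room : suc (k + k) ≤ (t + s) ∸ (w + w)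
      room = m+n≤o⇒m≤o∸n (suc (k + k))
               (subst₂ _≤_ (rearrange k w) (+-comm s t) 2g<s+t)

  consecutive-top : ∀ a n → consecutive a (suc n) ↭ (a ℤ.+ + n) ∷ consecutive a n
  consecutive-top a n = subst (_↭ f n ∷ map f (upTo n)) snoc (↭-sym (Perm.∷↭∷ʳ (f n) (map f (upTo n))))
    where
    f = λ i → a ℤ.+ + i
    snoc : map f (upTo n) ∷ʳ f n ≡ consecutive a (suc n)
    snoc = trans (sym (List.map-++ f (upTo n) (n ∷ []))) (cong (map f) (List.upTo-∷ʳ n))

  consecutive-bottom : ∀ a n → consecutive a (suc n) ≡ (a ℤ.+ + 0) ∷ consecutive (a ℤ.+ + 1) n
  consecutive-bottom a n = cong (a ℤ.+ + 0 ∷_) (begin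
    map f (applyUpTo suc n)     ≡⟨ List.map-applyUpTo suc f n ⟩
    applyUpTo (f ∘ suc) n       ≡⟨ List.map-upTo (f ∘ suc) n ⟨
    map (f ∘ suc) (upTo n)      ≡⟨ List.map-cong (λ i → sym (ℤP.+-assoc a (+ 1) (+ i))) (upTo n) ⟩
    consecutive (a ℤ.+ + 1) n   ∎)
    where
    open ≡-Reasoning
    f = λ i → a ℤ.+ + i

  remove-top : ∀ k {α A′ B a₀ s′ B*} → neighbours k α B ≤ neighbours k (a₀ ℤ.+ + s′) B* →
               closePairs k A′ B ≤ closePairs k (consecutive a₀ s′) B* →
               closePairs k (α ∷ A′) B ≤ closePairs k (consecutive a₀ (suc s′)) B*
  remove-top k {α} {A′} {B} {a₀} {s′} {B*} X≤ A′B≤ =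
    subst (neighbours k α B + closePairs k A′ B ≤_)
          (sym (closePairs-cong-↭ˡ k B* (consecutive-top a₀ s′))) (+-mono-≤ X≤ A′B≤)

  remove-bottom : ∀ k {A β B′ A* b₀ t′} → neighbours k β A ≤ neighbours k (b₀ ℤ.+ + 0) A* →
                  closePairs k A B′ ≤ closePairs k A* (consecutive (b₀ ℤ.+ + 1) t′) →
                  closePairs k A (β ∷ B′) ≤ closePairs k A* (consecutive b₀ (suc t′))
  remove-bottom k {A} {β} {B′} {A*} {b₀} {t′} Y≤ AB′≤ = begin
    closePairs k A (β ∷ B′)                             ≡⟨ closePairs-∷ʳ k A β B′ ⟩
    neighbours k β A + closePairs k A B′                ≤⟨ +-mono-≤ Y≤ AB′≤ ⟩
    neighbours k (b₀ ℤ.+ + 0) A* + closePairs k A* rest ≡⟨ closePairs-∷ʳ k A* (b₀ ℤ.+ + 0) rest ⟨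
    closePairs k A* ((b₀ ℤ.+ + 0) ∷ rest)               ≡⟨ cong (closePairs k A*) (consecutive-bottom b₀ t′) ⟨
    closePairs k A* (consecutive b₀ (suc t′))           ∎
    where
    open ≤-Reasoning
    rest = consecutive (b₀ ℤ.+ + 1) t′

  -- Twice the signed distance between the midpoints of consecutive a₀ s and consecutive b₀ t.
  offset : ℕ → ℕ → ℤ → ℤ → ℤ
  offset s t a₀ b₀ = (+ 2 ℤ.* a₀ ℤ.+ + s) ℤ.- (+ 2 ℤ.* b₀ ℤ.+ + t)

  Centred : ℕ → ℕ → ℤ → ℤ → Set
  Centred s t a₀ b₀ = ∣ offset s t a₀ b₀ ∣ ≤ 1

  offset-swap : ∀ s t a₀ b₀ → offset t s b₀ a₀ ≡ ℤ.- offset s t a₀ b₀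
  offset-swap s t a₀ b₀ = negate a₀ b₀ (+ s) (+ t)
    where
    negate : ∀ a b s t → (+ 2 ℤ.* b ℤ.+ t) ℤ.- (+ 2 ℤ.* a ℤ.+ s) ≡
                         ℤ.- ((+ 2 ℤ.* a ℤ.+ s) ℤ.- (+ 2 ℤ.* b ℤ.+ t))
    negate = solve-∀

  Centred-drop-top : ∀ s′ t a₀ b₀ {d} → offset (suc s′) t a₀ b₀ ≡ + d → d ≤ 1 →
                     Centred s′ t a₀ b₀
  Centred-drop-top s′ t a₀ b₀ offset≡d d≤1 = subst (λ z → ∣ z ∣ ≤ 1)
    (sym (trans (drop a₀ b₀ (+ s′) (+ t)) (cong (ℤ._- + 1) offset≡d))) (∣d-1∣≤1 d≤1)
    where
    drop : ∀ a b s t → (+ 2 ℤ.* a ℤ.+ s) ℤ.- (+ 2 ℤ.* b ℤ.+ t) ≡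
                       ((+ 2 ℤ.* a ℤ.+ (+ 1 ℤ.+ s)) ℤ.- (+ 2 ℤ.* b ℤ.+ t)) ℤ.- + 1
    drop = solve-∀

  Centred-drop-bottom : ∀ s t′ a₀ b₀ {d} → offset s (suc t′) a₀ b₀ ≡ + d → d ≤ 1 →
                        Centred s t′ a₀ (b₀ ℤ.+ + 1)
  Centred-drop-bottom s t′ a₀ b₀ offset≡d d≤1 = subst (λ z → ∣ z ∣ ≤ 1)
    (sym (trans (drop a₀ b₀ (+ s) (+ t′)) (cong (ℤ._- + 1) offset≡d))) (∣d-1∣≤1 d≤1)
    where
    drop : ∀ a b s t → (+ 2 ℤ.* a ℤ.+ s) ℤ.- (+ 2 ℤ.* (b ℤ.+ + 1) ℤ.+ t) ≡
                       ((+ 2 ℤ.* a ℤ.+ s) ℤ.- (+ 2 ℤ.* b ℤ.+ (+ 1 ℤ.+ t))) ℤ.- + 1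
    drop = solve-∀

  gap-from-offset : ∀ {s′ t′ a₀ b₀ d} → offset (suc s′) (suc t′) a₀ b₀ ≡ + d → d ≤ 1 →
                    ∃[ g ] a₀ ℤ.+ + s′ ≡ b₀ ℤ.+ + g × g + g < suc s′ + suc t′
  gap-from-offset {s′} {t′} {a₀} {b₀} {d} offset≡d d≤1 =
    let g , gap≡g , d+s′+t′≡2g =
          halve (sym (trans (twice a₀ b₀ (+ s′) (+ t′)) (cong (ℤ._+ + (s′ + t′)) offset≡d)))
    in g , trans (split a₀ b₀ (+ s′)) (cong (ℤ._+_ b₀) gap≡g) ,
       subst (_< suc s′ + suc t′) d+s′+t′≡2g
         (s≤s (≤-trans (+-monoˡ-≤ (s′ + t′) d≤1) (≤-reflexive (sym (+-suc s′ t′)))))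
    where
    twice : ∀ a b s t → + 2 ℤ.* ((a ℤ.+ s) ℤ.- b) ≡
                        ((+ 2 ℤ.* a ℤ.+ (+ 1 ℤ.+ s)) ℤ.- (+ 2 ℤ.* b ℤ.+ (+ 1 ℤ.+ t))) ℤ.+ (s ℤ.+ t)
    twice = solve-∀
    split : ∀ a b s → a ℤ.+ s ≡ b ℤ.+ ((a ℤ.+ s) ℤ.- b)
    split = solve-∀

  Optimal : ℕ → ℕ → Set
  Optimal k n = ∀ {s t A B} a₀ b₀ → s + t ≡ n → Unique A → Unique B →
                length A ≡ s → length B ≡ t → Centred s t a₀ b₀ →
                closePairs k A B ≤ closePairs k (consecutive a₀ s) (consecutive b₀ t)

  -- Deleting the top of the A-block or the bottom of the B-block lowers the
  -- offset by one, so with offset 0 or 1 either deletion keeps the blocks centred.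
  optimal-step : ∀ {k n} → Optimal k n →
                 ∀ {s′ t′ x y xs ys d} a₀ b₀ → suc s′ + suc t′ ≡ suc n →
                 Unique (x ∷ xs) → Unique (y ∷ ys) → length xs ≡ s′ → length ys ≡ t′ →
                 offset (suc s′) (suc t′) a₀ b₀ ≡ + d → d ≤ 1 →
                 closePairs k (x ∷ xs) (y ∷ ys) ≤
                 closePairs k (consecutive a₀ (suc s′)) (consecutive b₀ (suc t′))
  optimal-step {k} {n} optimal {s′} {t′} {x} {y} {xs} {ys} a₀ b₀ st uA uB ∣xs∣ ∣ys∣ offset≡d d≤1
    with α , A′ , A↭ , A′≤α ← extract-max x xs
       | β , B′ , B↭ , B′≤β ← extract-max y ys
       | g , top≡b₀+g , 2g<s+t ← gap-from-offset {s′} {t′} {a₀} {b₀} offset≡d d≤1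
    = Sum.[ delete-top , delete-bottom ]′
        (decide-removal k g X≤t Y≤s (neighbours≤2k+1 k α uB) (neighbours≤2k+1 k β uA)
           (neighbours-of-maxima k uA uB (extracted-max A↭ A′≤α) (extracted-max B↭ B′≤β)) 2g<s+t)
    where
    A = x ∷ xs
    B = y ∷ ys
    A* = consecutive a₀ (suc s′)
    B* = consecutive b₀ (suc t′)
    X≤t : neighbours k α B ≤ suc t′
    X≤t = subst (neighbours k α B ≤_) (cong suc ∣ys∣)
                (List.length-filter (λ b → ∣ α ℤ.- b ∣ ≤? k) B)
    Y≤s : neighbours k β A ≤ suc s′
    Y≤s = subst (neighbours k β A ≤_) (cong suc ∣xs∣)
                (List.length-filter (λ a → ∣ β ℤ.- a ∣ ≤? k) A)
    delete-top : neighbours k α B ≤ windowCount k g (suc t′) → closePairs k A B ≤ closePairs k A* B*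
    delete-top X≤ = begin
      closePairs k A B         ≡⟨ closePairs-cong-↭ˡ k B A↭ ⟩
      closePairs k (α ∷ A′) B  ≤⟨ remove-top k {α} {A′} {B} {a₀} {s′} {B*} X≤top A′B≤ ⟩
      closePairs k A* B*       ∎
      where
      open ≤-Reasoning
      X≤top : neighbours k α B ≤ neighbours k (a₀ ℤ.+ + s′) B*
      X≤top = ≤-trans X≤ (subst (λ e → windowCount k g (suc t′) ≤ neighbours k e B*) (sym top≡b₀+g)
                                (windowCount≤neighbours-above-bottom k b₀ g (suc t′)))
      A′B≤ : closePairs k A′ B ≤ closePairs k (consecutive a₀ s′) B*
      A′B≤ = optimal a₀ b₀ (suc-injective st) (extracted-unique A↭ uA) uB
               (trans (extracted-length A↭) ∣xs∣) (cong suc ∣ys∣)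
               (Centred-drop-top s′ (suc t′) a₀ b₀ offset≡d d≤1)
    delete-bottom : neighbours k β A ≤ windowCount k g (suc s′) → closePairs k A B ≤ closePairs k A* B*
    delete-bottom Y≤ = begin
      closePairs k A B         ≡⟨ closePairs-cong-↭ʳ k A B↭ ⟩
      closePairs k A (β ∷ B′)  ≤⟨ remove-bottom k {A} {β} {B′} {A*} {b₀} {t′} Y≤bottom AB′≤ ⟩
      closePairs k A* B*       ∎
      where
      open ≤-Reasoning
      Y≤bottom : neighbours k β A ≤ neighbours k (b₀ ℤ.+ + 0) A*
      Y≤bottom = ≤-trans Y≤ (windowCount≤neighbours-below-top k a₀ s′ (b₀ ℤ.+ + 0) g
                               (trans (cong (ℤ._+ + g) (ℤP.+-identityʳ b₀)) (sym top≡b₀+g)))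
      AB′≤ : closePairs k A B′ ≤ closePairs k A* (consecutive (b₀ ℤ.+ + 1) t′)
      AB′≤ = optimal a₀ (b₀ ℤ.+ + 1) (suc-injective (trans (sym (+-suc (suc s′) t′)) st))
               uA (extracted-unique B↭ uB) (cong suc ∣xs∣) (trans (extracted-length B↭) ∣ys∣)
               (Centred-drop-bottom (suc s′) t′ a₀ b₀ offset≡d d≤1)

  optimal : ∀ k n → Optimal k n
  optimal k n {A = []} _ _ _ _ _ _ _ _ = z≤n
  optimal k n {s} {t} {A = A@(_ ∷ _)} {[]} a₀ b₀ _ _ _ _ _ _ =
    subst (_≤ closePairs k (consecutive a₀ s) (consecutive b₀ t)) (sym (closePairs-[]ʳ k A)) z≤n
  optimal k zero {A = _ ∷ _} {_ ∷ _} _ _ () _ _ refl refl _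
  optimal k (suc n) {A = x ∷ xs} {y ∷ ys} a₀ b₀ st uA uB refl refl centred with ∣i∣≤1-cases centred
  ... | inj₁ (d , d≤1 , offset≡d) = optimal-step (optimal k n) a₀ b₀ st uA uB refl refl offset≡d d≤1
  ... | inj₂ offset≡-1 = begin
    closePairs k (x ∷ xs) (y ∷ ys)  ≡⟨ closePairs-comm k (x ∷ xs) (y ∷ ys) ⟩
    closePairs k (y ∷ ys) (x ∷ xs)  ≤⟨ optimal-step (optimal k n) b₀ a₀ (trans (+-comm (suc (length ys)) _) st)
                                         uB uA refl refl offset≡1 (s≤s z≤n) ⟩
    closePairs k B* A*              ≡⟨ closePairs-comm k B* A* ⟩
    closePairs k A* B*              ∎
    where
    open ≤-Reasoning
    A* = consecutive a₀ (suc (length xs))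
    B* = consecutive b₀ (suc (length ys))
    offset≡1 : offset (suc (length ys)) (suc (length xs)) b₀ a₀ ≡ + 1
    offset≡1 = trans (offset-swap (suc (length xs)) (suc (length ys)) a₀ b₀) (cong ℤ.-_ offset≡-1)

  closePairs≤centred : ∀ k {s t A B} a₀ b₀ → Unique A → Unique B →
                       length A ≡ s → length B ≡ t → Centred s t a₀ b₀ →
                       closePairs k A B ≤ closePairs k (consecutive a₀ s) (consecutive b₀ t)
  closePairs≤centred k a₀ b₀ = optimal k _ a₀ b₀ refl

  offset≡difference-of-end-sums : ∀ s t a₀ b₀ →
    offset s t a₀ b₀ ≡ ((+ 2 ℤ.* a₀ ℤ.+ + s) ℤ.- + 1) ℤ.- ((+ 2 ℤ.* b₀ ℤ.+ + t) ℤ.- + 1)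
  offset≡difference-of-end-sums s t a₀ b₀ = shift a₀ b₀ (+ s) (+ t)
    where
    shift : ∀ a b s t → (+ 2 ℤ.* a ℤ.+ s) ℤ.- (+ 2 ℤ.* b ℤ.+ t) ≡
                        ((+ 2 ℤ.* a ℤ.+ s) ℤ.- + 1) ℤ.- ((+ 2 ℤ.* b ℤ.+ t) ℤ.- + 1)
    shift = solve-∀

  parity⇒Centred : ∀ s t a₀ b₀ →
                   (s % 2 ≡ t % 2 → (+ 2 ℤ.* a₀ ℤ.+ + s) ℤ.- + 1 ≡ (+ 2 ℤ.* b₀ ℤ.+ + t) ℤ.- + 1) →
                   (¬ (s % 2 ≡ t % 2) →
                     ∣ ((+ 2 ℤ.* a₀ ℤ.+ + s) ℤ.- + 1) ℤ.- ((+ 2 ℤ.* b₀ ℤ.+ + t) ℤ.- + 1) ∣ ≡ 1) →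
                   Centred s t a₀ b₀
  parity⇒Centred s t a₀ b₀ same-parity different-parity with s % 2 ≟ t % 2
  ... | yes s≡t = subst (_≤ 1) (sym (cong ∣_∣ (begin
    offset s t a₀ b₀                      ≡⟨ offset≡difference-of-end-sums s t a₀ b₀ ⟩
    end-sum-A ℤ.- end-sum-B               ≡⟨ cong (ℤ._- end-sum-B) (same-parity s≡t) ⟩
    end-sum-B ℤ.- end-sum-B               ≡⟨ ℤP.+-inverseʳ end-sum-B ⟩
    + 0                                   ∎))) z≤n
    where
    open ≡-Reasoning
    end-sum-A = (+ 2 ℤ.* a₀ ℤ.+ + s) ℤ.- + 1
    end-sum-B = (+ 2 ℤ.* b₀ ℤ.+ + t) ℤ.- + 1
  ... | no s≢t =
    ≤-reflexive (trans (cong ∣_∣ (offset≡difference-of-end-sums s t a₀ b₀)) (different-parity s≢t))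

open import Data.Nat using (ℕ; NonZero; _%_)
open import Data.Integer using (ℤ; +_; _+_; _-_; _*_; ∣_∣)
open import Data.List using (List; length)
open import Data.List.Relation.Unary.Unique.Propositional using (Unique)
open import Relation.Binary.PropositionalEquality using (_≡_)
open import Relation.Nullary using (¬_)
open import Data.Nat using (_≤_)
open Rearrangement using (closePairs≤centred; parity⇒Centred)

lemma2 : (s t k : ℕ) → .{{NonZero s}} → .{{NonZero t}} →
         (A B : List ℤ) → Unique A → Unique B → length A ≡ s → length B ≡ t →
         (a₀ b₀ : ℤ) →
         (s % 2 ≡ t % 2 → (+ 2 * a₀ + + s) - + 1 ≡ (+ 2 * b₀ + + t) - + 1) →
         (¬ (s % 2 ≡ t % 2) → ∣ ((+ 2 * a₀ + + s) - + 1) - ((+ 2 * b₀ + + t) - + 1) ∣ ≡ 1) →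
         closePairs k A B ≤ closePairs k (consecutive a₀ s) (consecutive b₀ t)
lemma2 s t k A B uA uB ∣A∣ ∣B∣ a₀ b₀ same-parity different-parity =
  closePairs≤centred k a₀ b₀ uA uB ∣A∣ ∣B∣ (parity⇒Centred s t a₀ b₀ same-parity different-parity)
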